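{- Let $G$ be a connected chordal claw-free graph with clique tree $T_G=(\mathcal M,\mathcal E)$, and let $B\in\mathcal M$ be a fork clique. Then every neighbour of $B$ in $T_G$ is a star clique.
   Context: Graphs are finite simple undirected. A graph is chordal if every cycle of length at least 4 has a chord, and claw-free if it has no induced $K_{1,3}$. A max clique is an inclusion-maximal clique; $\mathcal M$ is the set of max cliques and $\mathcal M_v$ the set of max cliques containing $v$. A clique tree is a tree on $\mathcal M$ in which each $T[\mathcal M_v]$ is connected; a connected chordal claw-free graph has exactly one clique tree $T_G$, and each $T_G[\mathcal M_v]$ is a path. A max clique $B$ is a star clique if for every $v\in B$, $B$ is an end of the path $T_G[\mathcal M_v]$. A max clique $B$ of degree 3 in $T_G$ is a fork clique if (i) for every $v\in B$ there are two distinct neighbours $A,A'$ of $B$ with $\mathcal M_v=\{B,A,A'\}$, and (ii) for all distinct neighbours $A,A'$ of $B$ there is $v\in B$ with $\mathcal M_v=\{B,A,A'\}$. -}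

module Defs where

open import Level using (0ℓ)
open import Data.Nat using (ℕ; zero; suc; _≤_)
open import Data.Fin using (Fin; toℕ)
open import Data.Fin.Subset using (Subset; _∈_; _⊆_)
open import Data.Product using (Σ; ∃; _×_; _,_)
open import Data.Sum using (_⊎_)
open import Relation.Nullary using (¬_; Dec)
open import Relation.Binary.PropositionalEquality using (_≡_; _≢_)
open import Relation.Binary.Construct.Closure.ReflexiveTransitive using (Star)

record Graph : Set₁ where
  field
    n      : ℕ
    Adj    : Fin n → Fin n → Set
    adj?   : (u v : Fin n) → Dec (Adj u v)
    irrefl : ∀ v → ¬ Adj v v
    sym    : ∀ {u v} → Adj u v → Adj v u

Consec : (k : ℕ) → Fin k → Fin k → Set
Consec k i j = (toℕ j ≡ suc (toℕ i)) ⊎ (toℕ j ≡ 0 × suc (toℕ i) ≡ k)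

IsCycle : {A : Set} → (A → A → Set) → (k : ℕ) → (Fin k → A) → Set
IsCycle R k c = (∀ i j → c i ≡ c j → i ≡ j) × (∀ i j → Consec k i j → R (c i) (c j))

InducedWalk : {A : Set} → (A → A → Set) → (A → Set) → A → A → Set
InducedWalk R P = Star (λ x y → P x × P y × R x y)

module _ (G : Graph) where
  open Graph G

  Connected : Set
  Connected = ∀ u v → Star Adj u v

  Chordal : Set
  Chordal = ∀ k (c : Fin k → Fin n) → 4 ≤ k → IsCycle Adj k c →
            ∃ λ i → ∃ λ j → i ≢ j × ¬ Consec k i j × ¬ Consec k j i × Adj (c i) (c j)

  ClawFree : Set
  ClawFree = ∀ v a b c → Adj v a → Adj v b → Adj v c →
             a ≢ b → a ≢ c → b ≢ c →
             ¬ (¬ Adj a b × ¬ Adj a c × ¬ Adj b c)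

  IsClique : Subset n → Set
  IsClique K = ∀ u v → u ∈ K → v ∈ K → u ≢ v → Adj u v

  IsMaxClique : Subset n → Set
  IsMaxClique K = IsClique K × (∀ K′ → IsClique K′ → K ⊆ K′ → K′ ⊆ K)

  record CliqueTree : Set₁ where
    field
      E        : Subset n → Subset n → Set
      E-max    : ∀ {A B} → E A B → IsMaxClique A × IsMaxClique B
      E-sym    : ∀ {A B} → E A B → E B A
      E-irrefl : ∀ A → ¬ E A A
      E-conn   : ∀ A B → IsMaxClique A → IsMaxClique B → Star E A B
      E-acyc   : ∀ k (c : Fin k → Subset n) → 3 ≤ k → ¬ IsCycle E k c
      Mv-conn  : ∀ v A B → IsMaxClique A → IsMaxClique B → v ∈ A → v ∈ B →
                 InducedWalk E (λ C → v ∈ C) A B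

  module _ (T : CliqueTree) where
    open CliqueTree T

    -- B is an end of the path T[M_v] (v ∈ B): B has at most one
    -- neighbour in T[M_v].
    IsEndOf : Fin n → Subset n → Set
    IsEndOf v B = ∀ A A′ → E B A → E B A′ → v ∈ A → v ∈ A′ → A ≡ A′

    IsStarClique : Subset n → Set
    IsStarClique B = IsMaxClique B × (∀ v → v ∈ B → IsEndOf v B)

    MvIs : Fin n → Subset n → Subset n → Subset n → Set
    MvIs v B A A′ = ∀ C → IsMaxClique C → (v ∈ C → (C ≡ B ⊎ C ≡ A ⊎ C ≡ A′))
                                       × ((C ≡ B ⊎ C ≡ A ⊎ C ≡ A′) → v ∈ C)

    Degree3 : Subset n → Set
    Degree3 B = ∃ λ A₁ → ∃ λ A₂ → ∃ λ A₃ →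
                E B A₁ × E B A₂ × E B A₃ × A₁ ≢ A₂ × A₁ ≢ A₃ × A₂ ≢ A₃ ×
                (∀ A → E B A → A ≡ A₁ ⊎ A ≡ A₂ ⊎ A ≡ A₃)

    IsForkClique : Subset n → Set
    IsForkClique B = IsMaxClique B × Degree3 B
      × (∀ v → v ∈ B → ∃ λ A → ∃ λ A′ → E B A × E B A′ × A ≢ A′ × MvIs v B A A′)
      × (∀ A A′ → E B A → E B A′ → A ≢ A′ → ∃ λ v → v ∈ B × MvIs v B A A′)

module Submission where

-- Let A be a neighbour of the fork clique B and v ∈ A; we show that
-- v lies in at most one neighbour of A in T.
--   * If v ∈ B then M_v = {B, X, X′} for two neighbours X, X′ of B.  A neighbour
--     C of A containing v is B, X or X′, and X, X′ are excluded because B, A, X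
--     would form a triangle in the tree T.
--   * If v ∉ B pick another neighbour N of B and, by fork property (ii), a vertex
--     u with M_u = {B, A, N}; then u ∈ A.  Were v in two distinct neighbours C, C′
--     of A, choose x ∈ C ∖ A and y ∈ C′ ∖ A.  Since A separates its neighbours in
--     T and every edge of G lies in a maximal clique, x, y, u are pairwise distinct
--     and non-adjacent, so v, x, y, u form a claw.

open import Defs

open import Function using (_$_)
open import Data.Empty using (⊥; ⊥-elim)
open import Data.Product using (Σ; ∃; _×_; _,_; proj₁; proj₂)
open import Data.Sum using (_⊎_; inj₁; inj₂)
open import Data.Nat using (suc; _≤_; z≤n; s≤s)
open import Data.Nat.Properties using (suc-injective; m≤n⇒m≤1+n)
open import Data.Fin using (Fin; toℕ; zero; suc)
import Data.Fin.Properties as Fin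
open import Data.Fin.Subset using (Subset; _∈_; _∉_; _⊆_; _∪_; ⁅_⁆)
open import Data.Fin.Subset.Properties using (_∈?_; x∈⁅x⁆; x∈⁅y⁆⇒x≡y; x∈p∪q⁻; x∈p∪q⁺; ⊆-antisym)
open import Data.List using (List; []; _∷_; _++_; [_]; length; lookup; allFin)
open import Data.List.Properties using (++-assoc)
import Data.List.Membership.Propositional as L
import Data.List.Membership.DecPropositional as DecMembership
open import Data.List.Membership.Propositional.Properties using (∈-lookup; ∈-∃++; ∈-allFin)
open import Data.List.Relation.Unary.Any using (here; there)
open import Data.List.Relation.Unary.All using (All; []; _∷_)
import Data.List.Relation.Unary.All as All
open import Data.List.Relation.Unary.All.Properties using (¬Any⇒All¬) renaming (++⁺ to All-++⁺)
open import Data.List.Relation.Unary.AllPairs using ([]; _∷_)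
open import Data.List.Relation.Unary.Linked as Linked using (Linked; [-]; _∷_)
open import Data.List.Relation.Unary.Unique.Propositional using (Unique)
import Data.Vec.Properties as Vec
import Data.Bool.Properties as Bool
open import Relation.Nullary using (¬_; Dec; yes; no)
open import Relation.Nullary.Decidable using (¬?; _×-dec_; decidable-stable)
open import Relation.Binary using (DecidableEquality)
open import Relation.Binary.PropositionalEquality using (_≡_; _≢_; ≢-sym; refl; sym; trans; cong; subst)
open import Relation.Binary.Construct.Closure.ReflexiveTransitive using (Star; ε; _◅_; _◅◅_)

Avoiding : {X : Set} → (X → X → Set) → X → X → X → Set
Avoiding R a x y = x ≢ a × y ≢ a × R x y

induced⇒avoiding : ∀ {X : Set} {R : X → X → Set} {P : X → Set} {a x y} →
                   ¬ P a → InducedWalk R P x y → Star (Avoiding R a) x y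
induced⇒avoiding ¬Pa ε = ε
induced⇒avoiding ¬Pa ((Px , Py , r) ◅ w) =
  ((λ { refl → ¬Pa Px }) , (λ { refl → ¬Pa Py }) , r) ◅ induced⇒avoiding ¬Pa w

module Cycles {X : Set} (R : X → X → Set) where

  lookup-injective : ∀ {xs : List X} → Unique xs → ∀ i j → lookup xs i ≡ lookup xs j → i ≡ j
  lookup-injective (_ ∷ _) zero zero _ = refl
  lookup-injective (x∉ ∷ _) zero (suc j) eq = ⊥-elim (All.lookup x∉ (∈-lookup j) eq)
  lookup-injective (x∉ ∷ _) (suc i) zero eq = ⊥-elim (All.lookup x∉ (∈-lookup i) (sym eq))
  lookup-injective (_ ∷ u) (suc i) (suc j) eq = cong suc (lookup-injective u i j eq)

  lookup-linked : ∀ {xs : List X} → Linked R xs → ∀ i j → toℕ j ≡ suc (toℕ i) →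
                  R (lookup xs i) (lookup xs j)
  lookup-linked [-] zero zero ()
  lookup-linked (r ∷ _) zero (suc zero) _ = r
  lookup-linked (_ ∷ l) (suc i) (suc j) eq = lookup-linked l i j (suc-injective eq)
  lookup-linked (_ ∷ _) zero zero ()
  lookup-linked (_ ∷ _) zero (suc (suc _)) ()
  lookup-linked (_ ∷ _) (suc _) zero ()

  lookup-last : ∀ (xs : List X) y (i : Fin (length (xs ++ [ y ]))) →
                suc (toℕ i) ≡ length (xs ++ [ y ]) → lookup (xs ++ [ y ]) i ≡ y
  lookup-last [] y zero _ = refl
  lookup-last (_ ∷ []) y zero ()
  lookup-last (_ ∷ _ ∷ _) y zero ()
  lookup-last (_ ∷ xs) y (suc i) eq = lookup-last xs y i (suc-injective eq)

  closed-cycle : ∀ x zs y → Linked R (x ∷ zs ++ [ y ]) → Unique (x ∷ zs ++ [ y ]) → R y x →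
                 IsCycle R (length (x ∷ zs ++ [ y ])) (lookup (x ∷ zs ++ [ y ]))
  closed-cycle x zs y l u ryx = lookup-injective u , consecutive
    where
    consecutive : ∀ i j → Consec _ i j → R (lookup (x ∷ zs ++ [ y ]) i) (lookup (x ∷ zs ++ [ y ]) j)
    consecutive i j (inj₁ j≡1+i) = lookup-linked l i j j≡1+i
    consecutive i zero (inj₂ (_ , i-last)) = subst (λ z → R z x) (sym (lookup-last (x ∷ zs) y i i-last)) ryx
    consecutive i (suc j) (inj₂ (() , _))

-- An irreflexive relation without cycles of length ≥ 3, such as the edge relation
-- of a tree, separates the neighbours of each vertex.
module Forest {X : Set} (R : X → X → Set) (_≟_ : DecidableEquality X)
              (irrefl : ∀ x → ¬ R x x)
              (acyclic : ∀ k (c : Fin k → X) → 3 ≤ k → ¬ IsCycle R k c) where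

  open Cycles R
  open DecMembership _≟_ using () renaming (_∈?_ to _∈ˡ?_)

  R⇒≢ : ∀ {x y} → R x y → x ≢ y
  R⇒≢ {x} r refl = irrefl x r

  module LoopErasure {q a : X} (rqa : R q a) where

    SimplePath : X → Set
    SimplePath x = Σ (List X) λ ms → Linked R (x ∷ ms ++ q ∷ a ∷ []) × Unique (x ∷ ms ++ q ∷ a ∷ [])

    linked-suffix : ∀ pre {ys} → Linked R (pre ++ ys) → Linked R ys
    linked-suffix [] l = l
    linked-suffix (_ ∷ pre) l = linked-suffix pre (Linked.tail l)

    unique-suffix : ∀ pre {ys : List X} → Unique (pre ++ ys) → Unique ys
    unique-suffix [] u = u
    unique-suffix (_ ∷ pre) (_ ∷ u) = unique-suffix pre u

    extend : ∀ {x y} → x ≢ a → x ≢ q → R x y → y ≡ q ⊎ SimplePath y → SimplePath x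
    extend x≢a x≢q r (inj₁ refl) = [] , r ∷ rqa ∷ [-] , (x≢q ∷ x≢a ∷ []) ∷ (R⇒≢ rqa ∷ []) ∷ [] ∷ []
    extend {x} {y} x≢a x≢q r (inj₂ (ms , l , u)) with x ∈ˡ? (y ∷ ms)
    ... | no x∉ = y ∷ ms , r ∷ l , All-++⁺ (¬Any⇒All¬ _ x∉) (x≢q ∷ x≢a ∷ []) ∷ u
    ... | yes x∈ with ∈-∃++ x∈
    ... | pre , suf , split = suf , linked-suffix pre (subst (Linked R) path≡ l)
                                  , unique-suffix pre (subst Unique path≡ u)
      where
      path≡ : y ∷ ms ++ q ∷ a ∷ [] ≡ pre ++ x ∷ suf ++ q ∷ a ∷ []
      path≡ = trans (cong (_++ q ∷ a ∷ []) split) (++-assoc pre (x ∷ suf) (q ∷ a ∷ []))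

    erase : ∀ {x} → Star (Avoiding R a) x q → x ≡ q ⊎ SimplePath x
    erase ε = inj₁ refl
    erase {x} ((x≢a , _ , r) ◅ w) with x ≟ q
    ... | yes x≡q = inj₁ x≡q
    ... | no x≢q = inj₂ (extend x≢a x≢q r (erase w))

  separation : ∀ {a p q} → R q a → R a p → p ≢ q → ¬ Star (Avoiding R a) p q
  separation {a} {p} {q} rqa rap p≢q w with LoopErasure.erase rqa w
  ... | inj₁ p≡q = p≢q p≡q
  ... | inj₂ (ms , l , u) =
    acyclic _ _ (three≤ ms) (closed-cycle p (ms ++ [ q ]) a (reassoc (Linked R) l) (reassoc Unique u) rap)
    where
    reassoc : (P : List X → Set) → P (p ∷ ms ++ q ∷ a ∷ []) → P (p ∷ (ms ++ [ q ]) ++ [ a ])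
    reassoc P = subst (λ zs → P (p ∷ zs)) (sym (++-assoc ms [ q ] [ a ]))
    three≤ : ∀ zs → 3 ≤ length (p ∷ (zs ++ [ q ]) ++ [ a ])
    three≤ [] = s≤s (s≤s (s≤s z≤n))
    three≤ (_ ∷ zs) = m≤n⇒m≤1+n (three≤ zs)

  no-triangle : ∀ {a b c} → R a b → R b c → R c a → ⊥
  no-triangle rab rbc rca =
    separation rca rab (R⇒≢ rbc) ((≢-sym (R⇒≢ rab) , R⇒≢ rca , rbc) ◅ ε)

-- Every clique extends to a maximal one: greedily add each vertex of G that is
-- adjacent to all current members.
module MaximalCliques (G : Graph) where
  open Graph G renaming (sym to adj-sym)

  Blocked : Fin n → Subset n → Set
  Blocked w K = ∃ λ u → u ∈ K × u ≢ w × ¬ Adj u w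

  blocked? : ∀ w K → Dec (Blocked w K)
  blocked? w K = Fin.any? λ u → (u ∈? K) ×-dec ¬? (u Fin.≟ w) ×-dec ¬? (adj? u w)

  blocked-mono : ∀ {w K K′} → K ⊆ K′ → Blocked w K → Blocked w K′
  blocked-mono K⊆K′ (u , u∈K , u≢w , ¬adj) = u , K⊆K′ u∈K , u≢w , ¬adj

  singleton-clique : ∀ u → IsClique G ⁅ u ⁆
  singleton-clique u v w v∈ w∈ v≢w = ⊥-elim (v≢w (trans (x∈⁅y⁆⇒x≡y u v∈) (sym (x∈⁅y⁆⇒x≡y u w∈))))

  unblocked⇒adjacent : ∀ {w K x} → ¬ Blocked w K → x ∈ K → x ≢ w → Adj x w
  unblocked⇒adjacent {w} {x = x} ¬blocked x∈K x≢w =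
    decidable-stable (adj? x w) λ ¬adj → ¬blocked (x , x∈K , x≢w , ¬adj)

  add-unblocked : ∀ {w K} → IsClique G K → ¬ Blocked w K → IsClique G (K ∪ ⁅ w ⁆)
  add-unblocked {w} {K} cl ¬blocked u v u∈ v∈ u≢v with x∈p∪q⁻ K ⁅ w ⁆ u∈ | x∈p∪q⁻ K ⁅ w ⁆ v∈
  ... | inj₁ u∈K | inj₁ v∈K = cl u v u∈K v∈K u≢v
  ... | inj₁ u∈K | inj₂ v∈w with refl ← x∈⁅y⁆⇒x≡y w v∈w = unblocked⇒adjacent ¬blocked u∈K u≢v
  ... | inj₂ u∈w | inj₁ v∈K with refl ← x∈⁅y⁆⇒x≡y w u∈w =
    adj-sym (unblocked⇒adjacent ¬blocked v∈K (≢-sym u≢v))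
  ... | inj₂ u∈w | inj₂ v∈w = singleton-clique w u v u∈w v∈w u≢v

  insert : Fin n → Subset n → Subset n
  insert w K with blocked? w K
  ... | yes _ = K
  ... | no _ = K ∪ ⁅ w ⁆

  insert-⊆ : ∀ w K → K ⊆ insert w K
  insert-⊆ w K x∈K with blocked? w K
  ... | yes _ = x∈K
  ... | no _ = x∈p∪q⁺ (inj₁ x∈K)

  insert-keeps-clique : ∀ w K → IsClique G K → IsClique G (insert w K)
  insert-keeps-clique w K cl with blocked? w K
  ... | yes _ = cl
  ... | no ¬blocked = add-unblocked cl ¬blocked

  Settled : Fin n → Subset n → Set
  Settled w K = w ∈ K ⊎ Blocked w K

  settled-mono : ∀ {w K K′} → K ⊆ K′ → Settled w K → Settled w K′
  settled-mono K⊆K′ (inj₁ w∈K) = inj₁ (K⊆K′ w∈K)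
  settled-mono K⊆K′ (inj₂ blocked) = inj₂ (blocked-mono K⊆K′ blocked)

  insert-settles : ∀ w K → Settled w (insert w K)
  insert-settles w K with blocked? w K
  ... | yes blocked = inj₂ blocked
  ... | no _ = inj₁ (x∈p∪q⁺ (inj₂ (x∈⁅x⁆ w)))

  greedy : List (Fin n) → Subset n → Subset n
  greedy [] K = K
  greedy (w ∷ ws) K = greedy ws (insert w K)

  greedy-⊆ : ∀ ws K → K ⊆ greedy ws K
  greedy-⊆ [] K x∈K = x∈K
  greedy-⊆ (w ∷ ws) K x∈K = greedy-⊆ ws (insert w K) (insert-⊆ w K x∈K)

  greedy-clique : ∀ ws K → IsClique G K → IsClique G (greedy ws K)
  greedy-clique [] K cl = cl
  greedy-clique (w ∷ ws) K cl = greedy-clique ws (insert w K) (insert-keeps-clique w K cl)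

  greedy-settles : ∀ ws K {w} → w L.∈ ws → Settled w (greedy ws K)
  greedy-settles (w ∷ ws) K (here refl) = settled-mono (greedy-⊆ ws (insert w K)) (insert-settles w K)
  greedy-settles (_ ∷ ws) K (there w∈ws) = greedy-settles ws _ w∈ws

  extend-to-maximal : ∀ K → IsClique G K → Σ (Subset n) λ M → IsMaxClique G M × K ⊆ M
  extend-to-maximal K cl = M , (greedy-clique (allFin n) K cl , maximal) , greedy-⊆ (allFin n) K
    where
    M = greedy (allFin n) K
    maximal : ∀ K′ → IsClique G K′ → M ⊆ K′ → K′ ⊆ M
    maximal K′ cl′ M⊆K′ {w} w∈K′ with greedy-settles (allFin n) K (∈-allFin w)
    ... | inj₁ w∈M = w∈M
    ... | inj₂ (u , u∈M , u≢w , ¬adj) = ⊥-elim (¬adj (cl′ u w (M⊆K′ u∈M) w∈K′ u≢w))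

  edge-in-maximal : ∀ {u v} → Adj u v → Σ (Subset n) λ M → IsMaxClique G M × u ∈ M × v ∈ M
  edge-in-maximal {u} {v} uv with extend-to-maximal (⁅ u ⁆ ∪ ⁅ v ⁆) (add-unblocked (singleton-clique u) unblocked)
    where
    unblocked : ¬ Blocked v ⁅ u ⁆
    unblocked (u′ , u′∈ , _ , ¬adj) = ¬adj (subst (λ x → Adj x v) (sym (x∈⁅y⁆⇒x≡y u u′∈)) uv)
  ... | M , maxM , ⊆M = M , maxM , ⊆M (x∈p∪q⁺ (inj₁ (x∈⁅x⁆ u))) , ⊆M (x∈p∪q⁺ (inj₂ (x∈⁅x⁆ v)))

  vertex-outside : ∀ {M A} → IsMaxClique G M → IsClique G A → M ≢ A → ∃ λ x → x ∈ M × x ∉ A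
  vertex-outside {M} {A} (_ , maxM) clA M≢A with Fin.any? (λ x → (x ∈? M) ×-dec ¬? (x ∈? A))
  ... | yes (x , x∈M , x∉A) = x , x∈M , x∉A
  ... | no none = ⊥-elim (M≢A (⊆-antisym M⊆A (maxM A clA M⊆A)))
    where
    M⊆A : M ⊆ A
    M⊆A {x} x∈M = decidable-stable (x ∈? A) λ x∉A → none (x , x∈M , x∉A)

_≟ˢ_ : ∀ {n} → DecidableEquality (Subset n)
_≟ˢ_ = Vec.≡-dec Bool._≟_

module CliqueTreeFacts (G : Graph) (T : CliqueTree G) where
  open Graph G using (Adj)
  open CliqueTree T
  open MaximalCliques G
  open Forest E _≟ˢ_ E-irrefl E-acyc public using (R⇒≢; separation; no-triangle)

  max-left : ∀ {P Q} → E P Q → IsMaxClique G P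
  max-left ePQ = proj₁ (E-max ePQ)

  max-right : ∀ {P Q} → E P Q → IsMaxClique G Q
  max-right ePQ = proj₂ (E-max ePQ)

  walk-via : ∀ {x P Q A} → IsMaxClique G P → IsMaxClique G Q → x ∈ P → x ∈ Q → x ∉ A →
             Star (Avoiding E A) P Q
  walk-via {x} mP mQ xP xQ x∉A = induced⇒avoiding x∉A (Mv-conn x _ _ mP mQ xP xQ)

  apart : ∀ {A P Q} → E A P → E A Q → P ≢ Q → ¬ Star (Avoiding E A) P Q
  apart eAP eAQ = separation (E-sym eAQ) eAP

  no-shared-vertex : ∀ {A P Q x y} → E A P → E A Q → P ≢ Q →
                     x ∈ P → x ∉ A → y ∈ Q → y ∉ A → x ≢ y
  no-shared-vertex eAP eAQ P≢Q xP x∉A yQ _ refl =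
    apart eAP eAQ P≢Q (walk-via (max-right eAP) (max-right eAQ) xP yQ x∉A)

  no-crossing-edge : ∀ {A P Q x y} → E A P → E A Q → P ≢ Q →
                     x ∈ P → x ∉ A → y ∈ Q → y ∉ A → ¬ Adj x y
  no-crossing-edge eAP eAQ P≢Q xP x∉A yQ y∉A xy with edge-in-maximal xy
  ... | K , mK , xK , yK = apart eAP eAQ P≢Q
    (walk-via (max-right eAP) mK xP xK x∉A ◅◅ walk-via mK (max-right eAQ) yK yQ y∉A)

  private-neighbour : ∀ {A C v} → E A C → v ∈ A → v ∈ C → ∃ λ x → x ∈ C × x ∉ A × Adj v x
  private-neighbour eAC vA vC with vertex-outside (max-right eAC) (proj₁ (max-left eAC)) (≢-sym (R⇒≢ eAC))
  ... | x , xC , x∉A = x , xC , x∉A , proj₁ (max-right eAC) _ x vC xC λ { refl → x∉A vA }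

module ForkNeighbours (G : Graph) (claw-free : ClawFree G) (T : CliqueTree G) where
  open Graph G using (Adj)
  open CliqueTree T
  open MaximalCliques G
  open CliqueTreeFacts G T

  another-neighbour : ∀ {B A} → Degree3 G T B → E B A → ∃ λ N → E B N × A ≢ N
  another-neighbour (A₁ , A₂ , A₃ , e₁ , e₂ , _ , A₁≢A₂ , A₁≢A₃ , _ , only) eBA with only _ eBA
  ... | inj₁ refl = A₂ , e₂ , A₁≢A₂
  ... | inj₂ (inj₁ refl) = A₁ , e₁ , ≢-sym A₁≢A₂
  ... | inj₂ (inj₂ refl) = A₁ , e₁ , ≢-sym A₁≢A₃

  -- Case v ∈ B: M_v = {B, X, X′} with X, X′ neighbours of B, so the only neighbour
  -- of A containing v is B (X or X′ would close a triangle with B and A).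
  only-B : ∀ {v B A X X′ C} → E B A → E B X → E B X′ → MvIs G T v B X X′ →
           E A C → v ∈ C → C ≡ B
  only-B eBA eBX eBX′ Mv eAC vC with proj₁ (Mv _ (max-right eAC)) vC
  ... | inj₁ C≡B = C≡B
  ... | inj₂ (inj₁ refl) = ⊥-elim (no-triangle eBA eAC (E-sym eBX))
  ... | inj₂ (inj₂ refl) = ⊥-elim (no-triangle eBA eAC (E-sym eBX′))

  end-in-B : ∀ {B A v} → IsForkClique G T B → E B A → v ∈ B → IsEndOf G T v A
  end-in-B {v = v} (_ , _ , fork-i , _) eBA vB C C′ eAC eAC′ vC vC′ with fork-i v vB
  ... | X , X′ , eBX , eBX′ , _ , Mv =
    trans (only-B eBA eBX eBX′ Mv eAC vC) (sym (only-B eBA eBX eBX′ Mv eAC′ vC′))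

  -- Case v ∉ B: take u with M_u = {B, A, N}.  A vertex z outside A in a neighbour
  -- D ≠ B of A is not adjacent to u: a maximal clique through z and u would be
  -- B, A or N, and each choice yields a walk from D to B avoiding A.
  not-adjacent-to-u : ∀ {B A N u D z} → E B A → E B N → N ≢ A → MvIs G T u B A N →
                      E A D → D ≢ B → z ∈ D → z ∉ A → ¬ Adj z u
  not-adjacent-to-u eBA eBN N≢A Mu eAD D≢B zD z∉A zu with edge-in-maximal zu
  ... | K , mK , zK , uK with proj₁ (Mu K mK) uK
  ... | inj₁ refl = apart eAD (E-sym eBA) D≢B (walk-via (max-right eAD) mK zD zK z∉A)
  ... | inj₂ (inj₁ refl) = z∉A zK
  ... | inj₂ (inj₂ refl) = apart eAD (E-sym eBA) D≢B
    (walk-via (max-right eAD) mK zD zK z∉A ◅◅ ((N≢A , R⇒≢ eBA , E-sym eBN) ◅ ε))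

  -- Two distinct neighbours C, C′ of A through v would give a claw at v with
  -- leaves x ∈ C ∖ A, y ∈ C′ ∖ A and u ∈ A ∩ B.
  end-outside-B : ∀ {B A N u v} → E B A → E B N → A ≢ N → MvIs G T u B A N →
                  v ∈ A → v ∉ B → IsEndOf G T v A
  end-outside-B {B} {A} {u = u} {v = v} eBA eBN A≢N Mu vA v∉B C C′ eAC eAC′ vC vC′ with C ≟ˢ C′
  ... | yes C≡C′ = C≡C′
  ... | no C≢C′ with private-neighbour eAC vA vC | private-neighbour eAC′ vA vC′
  ... | x , xC , x∉A , vx | y , yC′ , y∉A , vy = ⊥-elim $ claw-free v x y u vx vy vu
        (no-shared-vertex eAC eAC′ C≢C′ xC x∉A yC′ y∉A) (λ { refl → x∉A uA }) (λ { refl → y∉A uA })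
        ( no-crossing-edge eAC eAC′ C≢C′ xC x∉A yC′ y∉A
        , not-adjacent-to-u eBA eBN (≢-sym A≢N) Mu eAC (λ { refl → v∉B vC }) xC x∉A
        , not-adjacent-to-u eBA eBN (≢-sym A≢N) Mu eAC′ (λ { refl → v∉B vC′ }) yC′ y∉A )
    where
    uA : u ∈ A
    uA = proj₂ (Mu A (max-right eBA)) (inj₂ (inj₁ refl))
    vu : Adj v u
    vu = proj₁ (max-right eBA) v u vA uA λ { refl → v∉B (proj₂ (Mu B (max-left eBA)) (inj₁ refl)) }

  fork-neighbour-is-star : ∀ {B A} → IsForkClique G T B → E B A → IsStarClique G T A
  fork-neighbour-is-star {B} {A} fork@(_ , degree3 , _ , fork-ii) eBA = max-right eBA , end
    where
    end : ∀ v → v ∈ A → IsEndOf G T v A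
    end v vA with v ∈? B
    ... | yes vB = end-in-B fork eBA vB
    ... | no v∉B with another-neighbour degree3 eBA
    ... | N , eBN , A≢N with fork-ii A N eBA eBN A≢N
    ... | u , _ , Mu = end-outside-B eBA eBN A≢N Mu vA v∉B

-- Corollary 3.8.
corollary3p8 : (G : Graph) → Connected G → Chordal G → ClawFree G →
    (T : CliqueTree G) → (B : Subset (Graph.n G)) → IsForkClique G T B →
    ∀ A → CliqueTree.E T B A → IsStarClique G T A
corollary3p8 G _ _ claw-free T B fork A eBA =
  ForkNeighbours.fork-neighbour-is-star G claw-free T fork eBA
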